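{- Let $\ell > 2$ be an even integer. Suppose $n = 2\ell + \alpha$, where $\alpha = \beta(\ell+2) + \gamma\ell$ for some nonnegative integers $\beta,\gamma$. Then the honeycomb toroidal graph $\mathrm{HTG}(2,n,\ell)$ is 2-spanning cyclable.
   Context: For integers $m\ge 1$, $\ell\ge 0$ and $n\ge 4$ with $n$ even and $m-\ell$ even, the honeycomb toroidal graph $\mathrm{HTG}(m,n,\ell)$ is the simple graph with vertex set $\{u_{i,j}: 0\le i\le m-1,\ 0\le j\le n-1\}$ (first subscript computed modulo $m$, second modulo $n$) whose edge set is the set of the following unordered pairs: $\{u_{i,j},u_{i,j+1}\}$ for all $i,j$ (vertical edges); $\{u_{i,j},u_{i+1,j}\}$ for all $0\le i\le m-2$ with $i+j$ odd (flat edges); and $\{u_{m-1,j},u_{0,j+\ell}\}$ for all $j$ having the same parity as $m$ (and $\ell$) (jump edges). A 2-factor of a graph is a spanning subgraph in which every vertex has valency 2. A graph $X$ is 2-spanning cyclable if for every pair of distinct vertices $u,v$ of $X$ there is a 2-factor of $X$ consisting of exactly two cycles such that $u$ and $v$ lie in different cycles. -}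

module Defs where

open import Data.Nat using (ℕ; zero; suc; _+_; _*_; _∸_; _≤_; _<_; _%_)
open import Data.Fin using (Fin; toℕ)
open import Data.Product using (Σ; _×_; _,_)
open import Data.Sum using (_⊎_)
open import Data.Empty using (⊥)
open import Data.List using (List; []; _∷_; _++_; [_]; length)
open import Data.List.Relation.Unary.Linked using (Linked)
open import Data.List.Relation.Unary.Unique.Propositional using (Unique)
open import Data.List.Membership.Propositional using (_∈_; _∉_)
open import Relation.Binary.PropositionalEquality using (_≡_; _≢_)

_≡_[mod_] : ℕ → ℕ → ℕ → Set
a ≡ b [mod n ] = Σ ℕ (λ q → (a ≡ b + q * n) ⊎ (b ≡ a + q * n))

Vertex : ℕ → ℕ → Set
Vertex m n = Fin m × Fin n

data HTGEdge (m n ℓ : ℕ) : Vertex m n → Vertex m n → Set where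
  vertical : ∀ (i : Fin m) (j j' : Fin n) →
             toℕ j' ≡ toℕ j + 1 [mod n ] →
             HTGEdge m n ℓ (i , j) (i , j')
  flat     : ∀ (i i' : Fin m) (j : Fin n) →
             toℕ i' ≡ suc (toℕ i) →
             (toℕ i + toℕ j) % 2 ≡ 1 →
             HTGEdge m n ℓ (i , j) (i' , j)
  jump     : ∀ (i i' : Fin m) (j j' : Fin n) →
             suc (toℕ i) ≡ m →
             toℕ i' ≡ 0 →
             toℕ j % 2 ≡ m % 2 →
             toℕ j' ≡ toℕ j + ℓ [mod n ] →
             HTGEdge m n ℓ (i , j) (i' , j')

HTGAdj : (m n ℓ : ℕ) → Vertex m n → Vertex m n → Set
HTGAdj m n ℓ u v = (u ≢ v) × (HTGEdge m n ℓ u v ⊎ HTGEdge m n ℓ v u)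

IsCycle : {V : Set} → (V → V → Set) → List V → Set
IsCycle Adj [] = ⊥
IsCycle Adj (x ∷ xs) =
  (3 ≤ length (x ∷ xs)) × Unique (x ∷ xs) × Linked Adj ((x ∷ xs) ++ [ x ])

IsTwoCycleTwoFactor : {V : Set} → (V → V → Set) → List V → List V → Set
IsTwoCycleTwoFactor {V} Adj C₁ C₂ =
  IsCycle Adj C₁ × IsCycle Adj C₂ ×
  (∀ (w : V) → w ∈ C₁ → w ∉ C₂) ×
  (∀ (w : V) → (w ∈ C₁) ⊎ (w ∈ C₂))

TwoSpanningCyclable : {V : Set} → (V → V → Set) → Set
TwoSpanningCyclable {V} Adj =
  ∀ (u v : V) → u ≢ v →
  Σ (List V) (λ C₁ → Σ (List V) (λ C₂ →
    IsTwoCycleTwoFactor Adj C₁ C₂ × u ∈ C₁ × v ∈ C₂))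

-- Two vertices in the same column lie in different rows, and the two rows form the required
-- 2-factor. Otherwise we use, for every even offset t, a 2-factor consisting of an inner cycle
-- on the columns t+1, …, t+ℓ−1 and an outer cycle on the columns t+ℓ, …, t+n. The outer cycle is
-- assembled from the columns t+ℓ, …, t+2ℓ joined by one jump edge, followed by β blocks of width
-- ℓ+2 and γ blocks of width ℓ; this is exactly where n = 2ℓ + β(ℓ+2) + γℓ is needed. Given two
-- vertices in different columns, put one of them at relative column 1 if some column is odd, at
-- relative column 2 otherwise. If the other vertex still lies in the inner cycle, it lies at
-- relative column ≥ 2 (resp. ≥ 4, by parity), so shifting t by ℓ−2 (resp. ℓ−4) separates them.

module Submission where

open import Defs
open import Data.Nat using (ℕ; _+_; _*_; _<_; _%_)
open import Relation.Binary.PropositionalEquality using (_≡_)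

open import Data.Nat using (zero; suc; _∸_; _≤_; z≤n; s≤s; s≤s⁻¹; z<s; NonZero)
open import Data.Nat.Properties
open import Data.Nat.DivMod
open import Data.Nat.Tactic.RingSolver using (solve-∀)
open import Data.Nat.Divisibility
  using (_∣_; divides; _∣0; ∣-refl; ∣m∣n⇒∣m+n; ∣m+n∣m⇒∣n; ∣n⇒∣m*n; m%n≡0⇒n∣m; n∣m⇒m%n≡0)
open import Data.Fin using (Fin; zero; suc; toℕ; fromℕ<)
open import Data.Fin.Properties using (toℕ-fromℕ<; toℕ-injective; toℕ<n)
open import Data.Product using (∃-syntax; _×_; _,_; proj₁; proj₂)
open import Data.Sum using (_⊎_; inj₁; inj₂) renaming ([_,_] to either)
open import Data.Empty using (⊥-elim)
open import Relation.Nullary using (yes; no)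
open import Data.List using (List; []; _∷_; _++_; [_]; length; map)
open import Data.List.Properties using (length-map; length-++-≤ˡ)
import Data.List.Relation.Unary.All.Properties as All
open import Data.List.Relation.Unary.All using ([]; lookup; tabulate)
open import Data.List.Relation.Unary.AllPairs using ([]; _∷_)
open import Data.List.Relation.Unary.Any using (here; there)
open import Data.List.Relation.Unary.Linked using (Linked; [-]; _∷_)
open import Data.List.Relation.Unary.Unique.Propositional using (Unique)
import Data.List.Relation.Unary.Unique.Propositional.Properties as Unique
open import Data.List.Membership.Propositional using (_∈_; _∉_)
open import Data.List.Membership.Propositional.Properties using (∈-map⁺; ∈-map⁻; ∈-++⁺ˡ; ∈-++⁺ʳ; ∈-++⁻)
open import Function using (_on_; _∘_)
open import Algebra.Properties.CommutativeSemigroup +-commutativeSemigroup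
  using (xy∙z≈xz∙y; xy∙z≈y∙xz; x∙yz≈y∙xz)
open import Level using (0ℓ)
open import Relation.Binary.PropositionalEquality
  using (_≢_; refl; sym; trans; cong; cong₂; subst; subst₂; module ≡-Reasoning)
open import Relation.Unary using (Pred; U; _∪_; _⊆_; _≐_; _⊥_)
open import Relation.Unary.Properties using (≐-trans)

private variable
  A B : Set

data Walk (R : A → A → Set) : A → List A → A → Set where
  []  : ∀ {a} → Walk R a [] a
  _∷_ : ∀ {a b xs z} → R a b → Walk R b xs z → Walk R a (b ∷ xs) z

module _ {R : A → A → Set} where

  infixr 5 _++ʷ_
  _++ʷ_ : ∀ {a b c xs ys} → Walk R a xs b → Walk R b ys c → Walk R a (xs ++ ys) c
  [] ++ʷ w = w
  (r ∷ v) ++ʷ w = r ∷ (v ++ʷ w)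

  walk⇒linked : ∀ {a xs z w} → Walk R a xs z → R z w → Linked R (a ∷ xs ++ [ w ])
  walk⇒linked [] r = r ∷ [-]
  walk⇒linked (r ∷ w) r′ = r ∷ walk⇒linked w r′

  closed-walk⇒cycle : ∀ {a xs z} → Walk R a xs z → R z a → 2 ≤ length xs →
                      Unique (a ∷ xs) → IsCycle R (a ∷ xs)
  closed-walk⇒cycle w r 2≤len u = s≤s 2≤len , u , walk⇒linked w r

map-walk : {R : B → B → Set} (f : A → B) → ∀ {a xs z} →
           Walk (R on f) a xs z → Walk R (f a) (map f xs) (f z)
map-walk f [] = []
map-walk f (r ∷ w) = r ∷ map-walk f w

two-factor-swap : ∀ {V : Set} {Adj : V → V → Set} {C₁ C₂} →
                  IsTwoCycleTwoFactor Adj C₁ C₂ → IsTwoCycleTwoFactor Adj C₂ C₁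
two-factor-swap (cycle₁ , cycle₂ , disjoint , cover) =
  cycle₂ , cycle₁ , (λ w w∈₂ w∈₁ → disjoint w w∈₁ w∈₂) , Data.Sum.swap ∘ cover

record Enumerates (P : Pred A 0ℓ) (xs : List A) : Set where
  field
    unique   : Unique xs
    sound    : ∀ {x} → x ∈ xs → P x
    complete : ∀ {x} → P x → x ∈ xs

open Enumerates

module _ {P Q : Pred A 0ℓ} where

  Enumerates-resp-≐ : P ≐ Q → ∀ {xs} → Enumerates P xs → Enumerates Q xs
  Enumerates-resp-≐ (P⊆Q , Q⊆P) e = record
    { unique = unique e ; sound = P⊆Q ∘ sound e ; complete = complete e ∘ Q⊆P }

  ++-enumerates : ∀ {xs ys} → Enumerates P xs → Enumerates Q ys → P ⊥ Q →
                  Enumerates (P ∪ Q) (xs ++ ys)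
  ++-enumerates {xs} ex ey P⊥Q = record
    { unique   = Unique.++⁺ (unique ex) (unique ey) λ (x∈xs , x∈ys) → P⊥Q (sound ex x∈xs , sound ey x∈ys)
    ; sound    = either (inj₁ ∘ sound ex) (inj₂ ∘ sound ey) ∘ ∈-++⁻ xs
    ; complete = either (∈-++⁺ˡ ∘ complete ex) (∈-++⁺ʳ xs ∘ complete ey)
    }

module _ {V P : Set} (f : P → V) (D : Pred P 0ℓ)
         (f-injective : ∀ {x y} → D x → D y → f x ≡ f y → x ≡ y) where

  Unique-map⁺ : ∀ {xs} → (∀ {x} → x ∈ xs → D x) → Unique xs → Unique (map f xs)
  Unique-map⁺ {[]} _ [] = []
  Unique-map⁺ {x ∷ xs} inD (x∉xs ∷ u) =
    All.map⁺ (tabulate λ y∈xs fx≡fy →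
      lookup x∉xs y∈xs (f-injective (inD (here refl)) (inD (there y∈xs)) fx≡fy))
    ∷ Unique-map⁺ (inD ∘ there) u

  module _ (Adj : V → V → Set) (f-onto : ∀ w → ∃[ x ] D x × f x ≡ w)
           {P₁ P₂ : Pred P 0ℓ} (P₁⊥P₂ : P₁ ⊥ P₂) (P₁∪P₂≐D : P₁ ∪ P₂ ≐ D) where

    closed-walks⇒two-factor :
      ∀ {a xs z b ys y} →
      Walk (Adj on f) a xs z → Adj (f z) (f a) → 2 ≤ length xs → Enumerates P₁ (a ∷ xs) →
      Walk (Adj on f) b ys y → Adj (f y) (f b) → 2 ≤ length ys → Enumerates P₂ (b ∷ ys) →
      IsTwoCycleTwoFactor Adj (map f (a ∷ xs)) (map f (b ∷ ys))
    closed-walks⇒two-factor {a} {xs} {_} {b} {ys} w₁ r₁ l₁ e₁ w₂ r₂ l₂ e₂ =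
      cycle w₁ r₁ l₁ (unique e₁) inD₁ , cycle w₂ r₂ l₂ (unique e₂) inD₂ , disjoint , cover
      where
      cycle : ∀ {c zs z} → Walk (Adj on f) c zs z → Adj (f z) (f c) → 2 ≤ length zs →
              Unique (c ∷ zs) → (∀ {x} → x ∈ c ∷ zs → D x) → IsCycle Adj (map f (c ∷ zs))
      cycle {zs = zs} w r l u inD =
        closed-walk⇒cycle (map-walk f w) r (subst (2 ≤_) (sym (length-map f zs)) l) (Unique-map⁺ inD u)
      inD₁ : ∀ {x} → x ∈ a ∷ xs → D x
      inD₁ = proj₁ P₁∪P₂≐D ∘ inj₁ ∘ sound e₁
      inD₂ : ∀ {x} → x ∈ b ∷ ys → D x
      inD₂ = proj₁ P₁∪P₂≐D ∘ inj₂ ∘ sound e₂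
      disjoint : ∀ w → w ∈ map f (a ∷ xs) → w ∉ map f (b ∷ ys)
      disjoint w w∈₁ w∈₂ with ∈-map⁻ f w∈₁ | ∈-map⁻ f w∈₂
      ... | x , x∈ , refl | y , y∈ , fx≡fy with f-injective (inD₁ x∈) (inD₂ y∈) fx≡fy
      ... | refl = P₁⊥P₂ (sound e₁ x∈ , sound e₂ y∈)
      cover : ∀ w → w ∈ map f (a ∷ xs) ⊎ w ∈ map f (b ∷ ys)
      cover w with f-onto w
      ... | x , Dx , refl =
        either (inj₁ ∘ ∈-map⁺ f ∘ complete e₁) (inj₂ ∘ ∈-map⁺ f ∘ complete e₂) (proj₂ P₁∪P₂≐D Dx)

Point : Set
Point = Fin 2 × ℕ

record Box (rows : Pred (Fin 2) 0ℓ) (lo hi : ℕ) (p : Point) : Set where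
  constructor box
  field
    row : rows (proj₁ p)
    lo≤ : lo ≤ proj₂ p
    <hi : proj₂ p < hi

Box-⊥-columns : ∀ {r r′ lo hi lo′ hi′} → hi ≤ lo′ → Box r lo hi ⊥ Box r′ lo′ hi′
Box-⊥-columns hi≤lo′ (box _ _ c<hi , box _ lo′≤c _) =
  <-irrefl refl (<-≤-trans c<hi (≤-trans hi≤lo′ lo′≤c))

Box-⊥-rows : ∀ {i j lo hi lo′ hi′} → i ≢ j → Box (_≡ i) lo hi ⊥ Box (_≡ j) lo′ hi′
Box-⊥-rows i≢j (box refl _ _ , box refl _ _) = i≢j refl

Box-∪-columns : ∀ {r lo mid hi} → lo ≤ mid → mid ≤ hi → Box r lo mid ∪ Box r mid hi ≐ Box r lo hi
Box-∪-columns {r} {lo} {mid} {hi} lo≤mid mid≤hi = split⇒whole , whole⇒split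
  where
  split⇒whole : Box r lo mid ∪ Box r mid hi ⊆ Box r lo hi
  split⇒whole (inj₁ (box ri lo≤c c<mid)) = box ri lo≤c (<-≤-trans c<mid mid≤hi)
  split⇒whole (inj₂ (box ri mid≤c c<hi)) = box ri (≤-trans lo≤mid mid≤c) c<hi
  whole⇒split : Box r lo hi ⊆ Box r lo mid ∪ Box r mid hi
  whole⇒split {_ , c} (box ri lo≤c c<hi) with c <? mid
  ... | yes c<mid = inj₁ (box ri lo≤c c<mid)
  ... | no c≮mid = inj₂ (box ri (≮⇒≥ c≮mid) c<hi)

0≢1 : _≢_ {A = Fin 2} zero (suc zero)
0≢1 ()

other-row : ∀ {i j k : Fin 2} → i ≢ j → k ≡ i ⊎ k ≡ j
other-row {zero}     {zero}     i≢j = ⊥-elim (i≢j refl)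
other-row {suc zero} {suc zero} i≢j = ⊥-elim (i≢j refl)
other-row {zero}     {suc zero} {zero}     _ = inj₁ refl
other-row {zero}     {suc zero} {suc zero} _ = inj₂ refl
other-row {suc zero} {zero}     {zero}     _ = inj₂ refl
other-row {suc zero} {zero}     {suc zero} _ = inj₁ refl

Box-∪-rows : ∀ {i j lo hi} → i ≢ j → Box (_≡ i) lo hi ∪ Box (_≡ j) lo hi ≐ Box U lo hi
Box-∪-rows {i} {j} {lo} {hi} i≢j = either forget-row forget-row , choose-row
  where
  forget-row : ∀ {r} → Box r lo hi ⊆ Box U lo hi
  forget-row (box _ lo≤c c<hi) = box _ lo≤c c<hi
  choose-row : Box U lo hi ⊆ Box (_≡ i) lo hi ∪ Box (_≡ j) lo hi
  choose-row (box _ lo≤c c<hi) = Data.Sum.map (λ r → box r lo≤c c<hi) (λ r → box r lo≤c c<hi) (other-row i≢j)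

module _ {r : Pred (Fin 2) 0ℓ} {lo mid hi : ℕ} (lo≤mid : lo ≤ mid) (mid≤hi : mid ≤ hi) {xs ys : List Point} where

  ++-columns : Enumerates (Box r lo mid) xs → Enumerates (Box r mid hi) ys →
               Enumerates (Box r lo hi) (xs ++ ys)
  ++-columns ex ey = Enumerates-resp-≐ (Box-∪-columns lo≤mid mid≤hi)
    (++-enumerates ex ey (Box-⊥-columns ≤-refl))

  ++-columns-descending : Enumerates (Box r mid hi) xs → Enumerates (Box r lo mid) ys →
                          Enumerates (Box r lo hi) (xs ++ ys)
  ++-columns-descending ex ey =
    Enumerates-resp-≐ (≐-trans (Data.Sum.swap , Data.Sum.swap) (Box-∪-columns lo≤mid mid≤hi))
    (++-enumerates ex ey (Box-⊥-columns ≤-refl ∘ Data.Product.swap))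

++-rows : ∀ {i j lo hi xs ys} → i ≢ j → Enumerates (Box (_≡ i) lo hi) xs →
          Enumerates (Box (_≡ j) lo hi) ys → Enumerates (Box U lo hi) (xs ++ ys)
++-rows i≢j ex ey = Enumerates-resp-≐ (Box-∪-rows i≢j) (++-enumerates ex ey (Box-⊥-rows i≢j))

[]-enumerates : ∀ {r a} → Enumerates (Box r a a) []
[]-enumerates = record
  { unique = [] ; sound = λ () ; complete = λ (box _ a≤c c<a) → ⊥-elim (<-irrefl refl (≤-<-trans a≤c c<a)) }

[-]-enumerates : ∀ i c → Enumerates (Box (_≡ i) c (suc c)) [ (i , c) ]
[-]-enumerates i c = record
  { unique   = [] ∷ []
  ; sound    = λ { (here refl) → box refl ≤-refl ≤-refl }
  ; complete = λ { (box refl c≤c′ c′<1+c) → here (cong (i ,_) (≤-antisym (s≤s⁻¹ c′<1+c) c≤c′)) }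
  }

up : Fin 2 → ℕ → ℕ → List Point
up i a zero    = []
up i a (suc m) = (i , a) ∷ up i (suc a) m

down : Fin 2 → ℕ → ℕ → List Point
down i a zero    = []
down i a (suc m) = (i , m + a) ∷ down i a m

length-up : ∀ i a m → length (up i a m) ≡ m
length-up i a zero    = refl
length-up i a (suc m) = cong suc (length-up i (suc a) m)

up-enumerates : ∀ i a m → Enumerates (Box (_≡ i) a (m + a)) (up i a m)
up-enumerates i a zero    = []-enumerates
up-enumerates i a (suc m) = ++-columns (n≤1+n a) (s≤s (m≤n+m a m)) ([-]-enumerates i a)
  (subst (λ hi → Enumerates (Box (_≡ i) (suc a) hi) (up i (suc a) m)) (+-suc m a) (up-enumerates i (suc a) m))

down-enumerates : ∀ i a m → Enumerates (Box (_≡ i) a (m + a)) (down i a m)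
down-enumerates i a zero    = []-enumerates
down-enumerates i a (suc m) =
  ++-columns-descending (m≤n+m a m) (n≤1+n (m + a)) ([-]-enumerates i (m + a)) (down-enumerates i a m)

repeat : (ℕ → List Point) → ℕ → ℕ → ℕ → List Point
repeat block w zero    e = []
repeat block w (suc k) e = block e ++ repeat block w k (w + e)

repeat-end : ∀ k w e → k * w + (w + e) ≡ suc k * w + e
repeat-end k w e = trans (sym (+-assoc (k * w) w e)) (cong (_+ e) (+-comm (k * w) w))

repeat-enumerates : ∀ {block w} → (∀ e → Enumerates (Box U (suc e) (suc (w + e))) (block e)) →
                    ∀ k e → Enumerates (Box U (suc e) (suc (k * w + e))) (repeat block w k e)
repeat-enumerates blocks zero    e = []-enumerates
repeat-enumerates {block} {w} blocks (suc k) e =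
  ++-columns (s≤s (m≤n+m e w)) (s≤s (≤-trans (m≤n+m (w + e) (k * w)) (≤-reflexive (repeat-end k w e))))
    (blocks e)
    (subst (λ hi → Enumerates (Box U (suc (w + e)) (suc hi)) (repeat block w k (w + e)))
      (repeat-end k w e) (repeat-enumerates blocks k (w + e)))

-- The edges of HTG(2, n, ℓ) before columns are reduced modulo n; `place t` below realises them
-- on the torus for every even offset t.
record StripEdges (ℓ : ℕ) (_~_ : Point → Point → Set) : Set where
  field
    symmetric : ∀ {p q} → p ~ q → q ~ p
    vertical-edge : ∀ i c → (i , c) ~ (i , suc c)
    flat-edge : ∀ c → 2 ∣ c → (zero , suc c) ~ (suc zero , suc c)
    jump-edge : ∀ c → 2 ∣ c → (suc zero , c) ~ (zero , c + ℓ)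

module StripWalks {ℓ : ℕ} {_~_ : Point → Point → Set} (E : StripEdges ℓ _~_) where
  open StripEdges E

  up-walk : ∀ i a m → Walk _~_ (i , a) (up i (suc a) m) (i , m + a)
  up-walk i a zero    = []
  up-walk i a (suc m) = vertical-edge i a ∷
    subst (Walk _~_ (i , suc a) (up i (suc (suc a)) m)) (cong (i ,_) (+-suc m a)) (up-walk i (suc a) m)

  down-walk : ∀ i a m → Walk _~_ (i , m + a) (down i a m) (i , a)
  down-walk i a zero    = []
  down-walk i a (suc m) = symmetric (vertical-edge i (m + a)) ∷ down-walk i a m

  repeat-walk : ∀ {block w} → 2 ∣ w →
                (∀ e → 2 ∣ e → Walk _~_ (suc zero , e) (block e) (suc zero , w + e)) →
                ∀ k e → 2 ∣ e → Walk _~_ (suc zero , e) (repeat block w k e) (suc zero , k * w + e)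
  repeat-walk 2∣w blocks zero    e 2∣e = []
  repeat-walk {block} {w} 2∣w blocks (suc k) e 2∣e = blocks e 2∣e ++ʷ
    subst (Walk _~_ (suc zero , w + e) (repeat block w k (w + e))) (cong (suc zero ,_) (repeat-end k w e))
      (repeat-walk 2∣w blocks k (w + e) (∣m∣n⇒∣m+n 2∣w 2∣e))

module Layout (k β γ : ℕ) where

  ℓ : ℕ
  ℓ = suc (suc k)

  2∣k⇒2∣ℓ : 2 ∣ k → 2 ∣ ℓ
  2∣k⇒2∣ℓ = ∣m∣n⇒∣m+n ∣-refl

  -- inner-cycle: row 0 over columns 1 … ℓ−1 and back along row 1, closed by flat edges.
  -- β-block e, entered from (1 , e): flat edge at column e+1, row 0 up to column e+ℓ+2, jump
  -- edge back to (1 , e+2), row 1 up to column e+ℓ+2. γ-block e, entered from (1 , e): jump edge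
  -- to (0 , e+ℓ), row 0 down to column e+1, flat edge, row 1 up to column e+ℓ.
  inner-cycle : List Point
  inner-cycle = up zero 1 (suc k) ++ down (suc zero) 1 (suc k)

  β-block : ℕ → List Point
  β-block e = (suc zero , suc e) ∷ (zero , suc e) ∷ (up zero (2 + e) (suc ℓ) ++ up (suc zero) (2 + e) (suc ℓ))

  γ-block : ℕ → List Point
  γ-block e = down zero (suc e) ℓ ++ up (suc zero) (suc e) ℓ

  blocks : ℕ → List Point
  blocks e = repeat β-block (ℓ + 2) β e ++ repeat γ-block ℓ γ (β * (ℓ + 2) + e)

  blocks-end : ℕ → ℕ
  blocks-end e = γ * ℓ + (β * (ℓ + 2) + e)

  ≤-blocks-end : ∀ e → e ≤ blocks-end e
  ≤-blocks-end e = ≤-trans (m≤n+m e (β * (ℓ + 2))) (m≤n+m (β * (ℓ + 2) + e) (γ * ℓ))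

  outer-cycle : List Point
  outer-cycle = (up zero ℓ (suc ℓ) ++ up (suc zero) ℓ (suc ℓ)) ++ blocks (ℓ + ℓ)

  inner-enumerates : Enumerates (Box U 1 ℓ) inner-cycle
  inner-enumerates = subst (λ hi → Enumerates (Box U 1 hi) inner-cycle) (+-comm (suc k) 1)
    (++-rows 0≢1 (up-enumerates zero 1 (suc k)) (down-enumerates (suc zero) 1 (suc k)))

  β-block-enumerates : ∀ e → Enumerates (Box U (suc e) (suc (ℓ + 2 + e))) (β-block e)
  β-block-enumerates e =
    subst (λ hi → Enumerates (Box U (suc e) hi) (β-block e)) (cong suc (sym (+-assoc ℓ 2 e)))
      (++-columns (n≤1+n (suc e)) (m≤n+m (2 + e) (suc ℓ))
        (++-rows (0≢1 ∘ sym) ([-]-enumerates (suc zero) (suc e)) ([-]-enumerates zero (suc e)))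
        (++-rows 0≢1 (up-enumerates zero (2 + e) (suc ℓ)) (up-enumerates (suc zero) (2 + e) (suc ℓ))))

  γ-block-enumerates : ∀ e → Enumerates (Box U (suc e) (suc (ℓ + e))) (γ-block e)
  γ-block-enumerates e = subst (λ hi → Enumerates (Box U (suc e) hi) (γ-block e)) (+-suc ℓ e)
    (++-rows 0≢1 (down-enumerates zero (suc e) ℓ) (up-enumerates (suc zero) (suc e) ℓ))

  blocks-enumerates : ∀ e → Enumerates (Box U (suc e) (suc (blocks-end e))) (blocks e)
  blocks-enumerates e =
    ++-columns (s≤s (m≤n+m e (β * (ℓ + 2)))) (s≤s (m≤n+m (β * (ℓ + 2) + e) (γ * ℓ)))
      (repeat-enumerates β-block-enumerates β e)
      (repeat-enumerates γ-block-enumerates γ (β * (ℓ + 2) + e))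

  outer-enumerates : Enumerates (Box U ℓ (suc (blocks-end (ℓ + ℓ)))) outer-cycle
  outer-enumerates =
    ++-columns (m≤n+m ℓ (suc ℓ)) (s≤s (≤-blocks-end (ℓ + ℓ)))
      (++-rows 0≢1 (up-enumerates zero ℓ (suc ℓ)) (up-enumerates (suc zero) ℓ (suc ℓ)))
      (blocks-enumerates (ℓ + ℓ))

  module Walks {_~_ : Point → Point → Set} (E : StripEdges ℓ _~_) (2∣k : 2 ∣ k) where
    open StripEdges E
    open StripWalks E

    2∣ℓ : 2 ∣ ℓ
    2∣ℓ = 2∣k⇒2∣ℓ 2∣k

    2∣ℓ+2 : 2 ∣ ℓ + 2
    2∣ℓ+2 = ∣m∣n⇒∣m+n 2∣ℓ ∣-refl

    inner-walk : Walk _~_ (zero , 1) (up zero 2 k ++ down (suc zero) 1 (suc k)) (suc zero , 1)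
    inner-walk = up-walk zero 1 k ++ʷ (turn ∷ down-walk (suc zero) 1 k)
      where
      turn : (zero , k + 1) ~ (suc zero , k + 1)
      turn = subst (λ c → (zero , c) ~ (suc zero , c)) (+-comm 1 k) (flat-edge k 2∣k)

    inner-closing : (suc zero , 1) ~ (zero , 1)
    inner-closing = symmetric (flat-edge 0 (2 ∣0))

    β-block-walk : ∀ e → 2 ∣ e → Walk _~_ (suc zero , e) (β-block e) (suc zero , ℓ + 2 + e)
    β-block-walk e 2∣e = vertical-edge (suc zero) e ∷ symmetric (flat-edge e 2∣e) ∷
      ((vertical-edge zero (suc e) ∷ up-walk zero (2 + e) ℓ) ++ʷ
       (back ∷ subst (Walk _~_ (suc zero , 2 + e) (up (suc zero) (3 + e) ℓ)) (cong (suc zero ,_) (sym (+-assoc ℓ 2 e)))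
                 (up-walk (suc zero) (2 + e) ℓ)))
      where
      back : (zero , ℓ + (2 + e)) ~ (suc zero , 2 + e)
      back = subst (λ c → (zero , c) ~ (suc zero , 2 + e)) (+-comm (2 + e) ℓ)
                   (symmetric (jump-edge (2 + e) (∣m∣n⇒∣m+n ∣-refl 2∣e)))

    γ-block-walk : ∀ e → 2 ∣ e → Walk _~_ (suc zero , e) (γ-block e) (suc zero , ℓ + e)
    γ-block-walk e 2∣e = across ∷
      (down-walk zero (suc e) (suc k) ++ʷ
       (flat-edge e 2∣e ∷
        subst (Walk _~_ (suc zero , suc e) (up (suc zero) (2 + e) (suc k))) (cong (suc zero ,_) (+-suc (suc k) e))
          (up-walk (suc zero) (suc e) (suc k))))
      where
      across : (suc zero , e) ~ (zero , suc k + suc e)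
      across = subst (λ c → (suc zero , e) ~ (zero , c)) (trans (+-comm e ℓ) (sym (+-suc (suc k) e))) (jump-edge e 2∣e)

    blocks-walk : ∀ e → 2 ∣ e → Walk _~_ (suc zero , e) (blocks e) (suc zero , blocks-end e)
    blocks-walk e 2∣e =
      repeat-walk 2∣ℓ+2 β-block-walk β e 2∣e ++ʷ
      repeat-walk 2∣ℓ γ-block-walk γ (β * (ℓ + 2) + e) (∣m∣n⇒∣m+n (∣n⇒∣m*n β 2∣ℓ+2) 2∣e)

    outer-walk : Walk _~_ (zero , ℓ) ((up zero (suc ℓ) ℓ ++ up (suc zero) ℓ (suc ℓ)) ++ blocks (ℓ + ℓ))
                         (suc zero , blocks-end (ℓ + ℓ))
    outer-walk = (up-walk zero ℓ ℓ ++ʷ (symmetric (jump-edge ℓ 2∣ℓ) ∷ up-walk (suc zero) ℓ ℓ)) ++ʷ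
                 blocks-walk (ℓ + ℓ) (∣m∣n⇒∣m+n 2∣ℓ 2∣ℓ)

module _ {n : ℕ} .{{_ : NonZero n}} where
  open ≡-Reasoning

  [m%n+k]%n≡[m+k]%n : ∀ x y → (x % n + y) % n ≡ (x + y) % n
  [m%n+k]%n≡[m+k]%n x y = begin
    (x % n + y) % n           ≡⟨ %-distribˡ-+ (x % n) y n ⟩
    (x % n % n + y % n) % n   ≡⟨ cong (λ r → (r + y % n) % n) (m%n%n≡m%n x n) ⟩
    (x % n + y % n) % n       ≡⟨ %-distribˡ-+ x y n ⟨
    (x + y) % n               ∎

  [m+k]%n≡[m+k%n]%n : ∀ x y → (x + y) % n ≡ (x + y % n) % n
  [m+k]%n≡[m+k%n]%n x y = begin
    (x + y) % n       ≡⟨ cong (_% n) (+-comm x y) ⟩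
    (y + x) % n       ≡⟨ [m%n+k]%n≡[m+k]%n y x ⟨
    (y % n + x) % n   ≡⟨ cong (_% n) (+-comm (y % n) x) ⟩
    (x + y % n) % n   ∎

  m%n≡m[mod] : ∀ x → (x % n) ≡ x [mod n ]
  m%n≡m[mod] x = x / n , inj₂ (m≡m%n+[m/n]*n x n)

  [m+d]%n≢m%n : ∀ x {d} → 0 < d → d < n → (x + d) % n ≢ x % n
  [m+d]%n≢m%n x {d} 0<d d<n eq with x % n + d <? n | m%n<n x n
  ... | yes r+d<n | _ = <-irrefl (sym r+d≡r) (m<m+n (x % n) 0<d)
    where
    r+d≡r : x % n + d ≡ x % n
    r+d≡r = trans (sym (m<n⇒m%n≡m r+d<n)) (trans ([m%n+k]%n≡[m+k]%n x d) eq)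
  ... | no r+d≮n | r<n = <⇒≢ d<n (+-cancelˡ-≡ (x % n) d n (trans (sym (m∸n+n≡m n≤r+d)) (cong (_+ n) wrapped)))
    where
    n≤r+d : n ≤ x % n + d
    n≤r+d = ≮⇒≥ r+d≮n
    wrapped : x % n + d ∸ n ≡ x % n
    wrapped = begin
      x % n + d ∸ n           ≡⟨ m<n⇒m%n≡m (m<n+o⇒m∸n<o (x % n + d) n (+-mono-< r<n d<n)) ⟨
      (x % n + d ∸ n) % n     ≡⟨ m≤n⇒[n∸m]%m≡n%m n≤r+d ⟩
      (x % n + d) % n         ≡⟨ [m%n+k]%n≡[m+k]%n x d ⟩
      (x + d) % n             ≡⟨ eq ⟩
      x % n                   ∎

  %-injective-window : ∀ {x y} → x ≤ y → y < x + n → x % n ≡ y % n → x ≡ y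
  %-injective-window {x} x≤y y<x+n eq with m≤n⇒∃[o]m+o≡n x≤y
  ... | zero  , refl = sym (+-identityʳ x)
  ... | suc d , refl = ⊥-elim ([m+d]%n≢m%n x z<s (+-cancelˡ-< x (suc d) _ y<x+n) (sym eq))

2∣m⇒[1+m]%2≡1 : ∀ {x} → 2 ∣ x → suc x % 2 ≡ 1
2∣m⇒[1+m]%2≡1 (divides q refl) = [m+kn]%n≡m%n 1 q 2

even⊎odd : ∀ x → 2 ∣ x ⊎ ∃[ y ] x ≡ suc y × 2 ∣ y
even⊎odd zero = inj₁ (2 ∣0)
even⊎odd (suc x) with even⊎odd x
... | inj₁ 2∣x = inj₂ (x , refl , 2∣x)
... | inj₂ (y , refl , 2∣y) = inj₁ (∣m∣n⇒∣m+n ∣-refl 2∣y)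

∣m∣n⇒∣m∸n : ∀ {d x y} → y ≤ x → d ∣ x → d ∣ y → d ∣ x ∸ y
∣m∣n⇒∣m∸n {d} {x} {y} y≤x d∣x d∣y = ∣m+n∣m⇒∣n (subst (d ∣_) (sym (m+[n∸m]≡n y≤x)) d∣x) d∣y

HTGAdj-sym : ∀ {m n ℓ u v} → HTGAdj m n ℓ u v → HTGAdj m n ℓ v u
HTGAdj-sym (u≢v , edge) = u≢v ∘ sym , Data.Sum.swap edge

module Torus (n-1 ℓ : ℕ) (2∣n : 2 ∣ suc n-1) (2≤n-1 : 2 ≤ n-1) where
  open ≡-Reasoning

  n : ℕ
  n = suc n-1

  Adj : Vertex 2 n → Vertex 2 n → Set
  Adj = HTGAdj 2 n ℓ

  column : ℕ → Fin n
  column x = fromℕ< (m%n<n x n)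

  toℕ-column : ∀ x → toℕ (column x) ≡ x % n
  toℕ-column x = toℕ-fromℕ< (m%n<n x n)

  column-cong : ∀ x y → x % n ≡ y % n → column x ≡ column y
  column-cong x y eq = toℕ-injective (trans (toℕ-column x) (trans eq (sym (toℕ-column y))))

  column-toℕ : ∀ j → column (toℕ j) ≡ j
  column-toℕ j = toℕ-injective (trans (toℕ-column (toℕ j)) (m<n⇒m%n≡m (toℕ<n j)))

  column-+[mod] : ∀ x y → toℕ (column (x + y)) ≡ toℕ (column x) + y [mod n ]
  column-+[mod] x y = subst₂ (λ a b → a ≡ b [mod n ])
    (trans ([m%n+k]%n≡[m+k]%n x y) (sym (toℕ-column (x + y)))) (cong (_+ y) (sym (toℕ-column x)))
    (m%n≡m[mod] (x % n + y))

  column-parity : ∀ x → toℕ (column x) % 2 ≡ x % 2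
  column-parity x = trans (cong (_% 2) (toℕ-column x)) (m∣n⇒o%n%m≡o%m 2 n x 2∣n)

  vertical-adj : ∀ i x → Adj (i , column x) (i , column (suc x))
  vertical-adj i x = distinct , inj₁ (vertical i (column x) (column (suc x)) step)
    where
    step : toℕ (column (suc x)) ≡ toℕ (column x) + 1 [mod n ]
    step = subst (λ y → toℕ (column y) ≡ toℕ (column x) + 1 [mod n ]) (+-comm x 1) (column-+[mod] x 1)
    distinct : (i , column x) ≢ (i , column (suc x))
    distinct eq = [m+d]%n≢m%n x z<s (s≤s (≤-trans (s≤s z≤n) 2≤n-1))
      (begin
        (x + 1) % n              ≡⟨ cong (_% n) (+-comm x 1) ⟩
        suc x % n                ≡⟨ toℕ-column (suc x) ⟨
        toℕ (column (suc x))     ≡⟨ cong (toℕ ∘ proj₂) eq ⟨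
        toℕ (column x)           ≡⟨ toℕ-column x ⟩
        x % n                    ∎)

  flat-adj : ∀ x → 2 ∣ x → Adj (zero , column (suc x)) (suc zero , column (suc x))
  flat-adj x 2∣x = 0≢1 ∘ cong proj₁ ,
    inj₁ (flat zero (suc zero) (column (suc x)) refl (trans (column-parity (suc x)) (2∣m⇒[1+m]%2≡1 2∣x)))

  jump-adj : ∀ x → 2 ∣ x → Adj (suc zero , column x) (zero , column (x + ℓ))
  jump-adj x 2∣x = 0≢1 ∘ sym ∘ cong proj₁ ,
    inj₁ (jump (suc zero) zero (column x) (column (x + ℓ)) refl refl
               (trans (column-parity x) (n∣m⇒m%n≡0 x 2 2∣x)) (column-+[mod] x ℓ))

  place : ℕ → Point → Vertex 2 n
  place t (i , c) = i , column (c + t)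

  place-strip : ∀ {t} → 2 ∣ t → StripEdges ℓ (Adj on place t)
  place-strip {t} 2∣t = record
    { symmetric     = HTGAdj-sym
    ; vertical-edge = λ i c → vertical-adj i (c + t)
    ; flat-edge     = λ c 2∣c → flat-adj (c + t) (∣m∣n⇒∣m+n 2∣c 2∣t)
    ; jump-edge     = λ c 2∣c → subst (λ y → Adj (suc zero , column (c + t)) (zero , column y))
                                      (xy∙z≈xz∙y c t ℓ) (jump-adj (c + t) (∣m∣n⇒∣m+n 2∣c 2∣t))
    }

  place-+n : ∀ t i c → place t (i , n + c) ≡ place t (i , c)
  place-+n t i c = cong (i ,_)
    (column-cong (n + c + t) (c + t) (trans (cong (_% n) (+-assoc n c t)) (%-remove-+ˡ (c + t) ∣-refl)))

  place-shift : ∀ t i c {d} → d ≤ n → place (t + n ∸ d) (i , d + c) ≡ place t (i , c)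
  place-shift t i c {d} d≤n = trans (cong (λ x → i , column x) shifted) (place-+n t i c)
    where
    shifted : d + c + (t + n ∸ d) ≡ n + c + t
    shifted = begin
      d + c + (t + n ∸ d)     ≡⟨ xy∙z≈y∙xz d c (t + n ∸ d) ⟩
      c + (d + (t + n ∸ d))   ≡⟨ cong (c +_) (m+[n∸m]≡n (≤-trans d≤n (m≤n+m n t))) ⟩
      c + (t + n)             ≡⟨ cong (c +_) (+-comm t n) ⟩
      c + (n + t)             ≡⟨ x∙yz≈y∙xz c n t ⟩
      n + (c + t)             ≡⟨ +-assoc n c t ⟨
      n + c + t               ∎

  column-injective : ∀ t {a b} → a ≤ b → 1 ≤ a → b < suc n → column (a + t) ≡ column (b + t) → a ≡ b
  column-injective t {a} {b} a≤b 1≤a b≤n eq =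
    +-cancelʳ-≡ t a b (%-injective-window (+-monoˡ-≤ t a≤b) window
      (trans (sym (toℕ-column (a + t))) (trans (cong toℕ eq) (toℕ-column (b + t)))))
    where
    window : b + t < a + t + n
    window = subst (b + t <_) (xy∙z≈xz∙y a n t) (+-monoˡ-< t (<-≤-trans b≤n (+-monoˡ-≤ n 1≤a)))

  anchor : ∀ {a t} i j → a + t ≡ toℕ j + n → place t (i , a) ≡ (i , j)
  anchor {a} {t} i j a+t≡ = cong (i ,_) (trans
    (column-cong (a + t) (toℕ j) (trans (cong (_% n) a+t≡) ([m+n]%n≡m%n (toℕ j) n))) (column-toℕ j))

  column-parity⇒even : ∀ {c t} → 2 ∣ t → 2 ∣ toℕ (column (c + t)) → 2 ∣ c
  column-parity⇒even {c} {t} 2∣t 2∣col = ∣m+n∣m⇒∣n (subst (2 ∣_) (+-comm c t) 2∣c+t) 2∣t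
    where
    2∣c+t : 2 ∣ c + t
    2∣c+t = m%n≡0⇒n∣m (c + t) 2 (trans (sym (column-parity (c + t))) (n∣m⇒m%n≡0 _ 2 2∣col))

  place-injective : ∀ {t p q} → Box U 1 (suc n) p → Box U 1 (suc n) q → place t p ≡ place t q → p ≡ q
  place-injective {t} {_ , a} {_ , b} (box _ 1≤a a≤n) (box _ 1≤b b≤n) eq with ≤-total a b
  ... | inj₁ a≤b = cong₂ _,_ (cong proj₁ eq) (column-injective t a≤b 1≤a b≤n (cong proj₂ eq))
  ... | inj₂ b≤a = cong₂ _,_ (cong proj₁ eq) (sym (column-injective t b≤a 1≤b a≤n (cong proj₂ (sym eq))))

  place-onto : ∀ t w → ∃[ p ] Box U 1 (suc n) p × place t p ≡ w
  place-onto t (i , j) with t % n <? toℕ j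
  ... | yes r<A = (i , toℕ j ∸ t % n) ,
                  box _ (m<n⇒0<n∸m r<A) (s≤s (≤-trans (m∸n≤m (toℕ j) (t % n)) (<⇒≤ (toℕ<n j)))) ,
                  cong (i ,_) (trans (column-cong (toℕ j ∸ t % n + t) (toℕ j) reaches) (column-toℕ j))
    where
    reaches : (toℕ j ∸ t % n + t) % n ≡ toℕ j % n
    reaches = trans ([m+k]%n≡[m+k%n]%n (toℕ j ∸ t % n) t) (cong (_% n) (m∸n+n≡m (<⇒≤ r<A)))
  ... | no r≮A = (i , n ∸ t % n + toℕ j) ,
                 box _ (≤-trans (m<n⇒0<n∸m (m%n<n t n)) (m≤m+n (n ∸ t % n) (toℕ j))) (s≤s at-most-n) ,
                 cong (i ,_) (trans (column-cong (n ∸ t % n + toℕ j + t) (toℕ j) reaches) (column-toℕ j))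
    where
    at-most-n : n ∸ t % n + toℕ j ≤ n
    at-most-n = ≤-trans (+-monoʳ-≤ (n ∸ t % n) (≮⇒≥ r≮A)) (≤-reflexive (m∸n+n≡m (<⇒≤ (m%n<n t n))))
    reaches : (n ∸ t % n + toℕ j + t) % n ≡ toℕ j % n
    reaches = begin
      (n ∸ t % n + toℕ j + t) % n         ≡⟨ [m+k]%n≡[m+k%n]%n (n ∸ t % n + toℕ j) t ⟩
      (n ∸ t % n + toℕ j + t % n) % n     ≡⟨ cong (_% n) (xy∙z≈xz∙y (n ∸ t % n) (toℕ j) (t % n)) ⟩
      (n ∸ t % n + t % n + toℕ j) % n     ≡⟨ cong (λ x → (x + toℕ j) % n) (m∸n+n≡m (<⇒≤ (m%n<n t n))) ⟩
      (n + toℕ j) % n                     ≡⟨ %-remove-+ˡ (toℕ j) ∣-refl ⟩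
      toℕ j % n                           ∎

  two-factor-of-walks : ∀ t {P₁ P₂} → P₁ ⊥ P₂ → P₁ ∪ P₂ ≐ Box U 1 (suc n) → ∀ {a xs z b ys y} →
    Walk (Adj on place t) a xs z → Adj (place t z) (place t a) → 2 ≤ length xs → Enumerates P₁ (a ∷ xs) →
    Walk (Adj on place t) b ys y → Adj (place t y) (place t b) → 2 ≤ length ys → Enumerates P₂ (b ∷ ys) →
    IsTwoCycleTwoFactor Adj (map (place t) (a ∷ xs)) (map (place t) (b ∷ ys))
  two-factor-of-walks t P₁⊥P₂ P₁∪P₂≐D =
    closed-walks⇒two-factor (place t) (Box U 1 (suc n)) place-injective Adj (place-onto t) P₁⊥P₂ P₁∪P₂≐D

  row-enumerates : ∀ i → Enumerates (Box (_≡ i) 1 (suc n)) (up i 1 n)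
  row-enumerates i = subst (λ hi → Enumerates (Box (_≡ i) 1 hi) (up i 1 n)) (+-comm n 1) (up-enumerates i 1 n)

  ∈-row : ∀ i j → (i , j) ∈ map (place 0) (up i 1 n)
  ∈-row i j with place-onto 0 (i , j)
  ... | (_ , c) , box _ 1≤c c≤n , refl = ∈-map⁺ (place 0) (complete (row-enumerates i) (box refl 1≤c c≤n))

  row-factor : ∀ {i j} → i ≢ j → IsTwoCycleTwoFactor Adj (map (place 0) (up i 1 n)) (map (place 0) (up j 1 n))
  row-factor {i} {j} i≢j = two-factor-of-walks 0 (Box-⊥-rows i≢j) (Box-∪-rows i≢j)
    (row-walk i) (row-closing i) (row-length i) (row-enumerates i)
    (row-walk j) (row-closing j) (row-length j) (row-enumerates j)
    where
    open StripEdges (place-strip (2 ∣0))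
    open StripWalks (place-strip (2 ∣0))
    row-walk : ∀ i → Walk (Adj on place 0) (i , 1) (up i 2 n-1) (i , n-1 + 1)
    row-walk i = up-walk i 1 n-1
    row-closing : ∀ i → Adj (place 0 (i , n-1 + 1)) (place 0 (i , 1))
    row-closing i = subst (Adj (place 0 (i , n-1 + 1))) (place-+n 0 i 1) (vertical-edge i (n-1 + 1))
    row-length : ∀ i → 2 ≤ length (up i 2 n-1)
    row-length i = subst (2 ≤_) (sym (length-up i 2 n-1)) 2≤n-1

module Separation (k β γ n-1 : ℕ) (2∣k : 2 ∣ k) (2≤k : 2 ≤ k)
                  (n≡ : suc n-1 ≡ Layout.blocks-end k β γ (Layout.ℓ k β γ + Layout.ℓ k β γ)) where
  open Layout k β γ

  2∣ℓ : 2 ∣ ℓ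
  2∣ℓ = 2∣k⇒2∣ℓ 2∣k

  2∣n : 2 ∣ suc n-1
  2∣n = subst (2 ∣_) (sym n≡)
    (∣m∣n⇒∣m+n (∣n⇒∣m*n γ 2∣ℓ) (∣m∣n⇒∣m+n (∣n⇒∣m*n β (∣m∣n⇒∣m+n 2∣ℓ ∣-refl)) (∣m∣n⇒∣m+n 2∣ℓ 2∣ℓ)))

  ℓ+ℓ≤n : ℓ + ℓ ≤ suc n-1
  ℓ+ℓ≤n = subst (ℓ + ℓ ≤_) (sym n≡) (≤-blocks-end (ℓ + ℓ))

  2≤n-1 : 2 ≤ n-1
  2≤n-1 = s≤s⁻¹ (≤-trans (s≤s (s≤s (≤-trans (s≤s z≤n) 2≤k))) (≤-trans (m≤m+n ℓ ℓ) ℓ+ℓ≤n))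

  open Torus n-1 ℓ 2∣n 2≤n-1

  outer-enumerates′ : Enumerates (Box U ℓ (suc n)) outer-cycle
  outer-enumerates′ = subst (λ hi → Enumerates (Box U ℓ (suc hi)) outer-cycle) (sym n≡) outer-enumerates

  layout-factor : ∀ {t} → 2 ∣ t →
                  IsTwoCycleTwoFactor Adj (map (place t) inner-cycle) (map (place t) outer-cycle)
  layout-factor {t} 2∣t =
    two-factor-of-walks t (Box-⊥-columns ≤-refl) (Box-∪-columns (s≤s z≤n) ℓ≤1+n)
      inner-walk inner-closing inner-length inner-enumerates
      outer-walk outer-closing (s≤s (s≤s z≤n)) outer-enumerates′
    where
    open Walks (place-strip 2∣t) 2∣k
    ℓ≤1+n : ℓ ≤ suc n
    ℓ≤1+n = ≤-trans (m≤m+n ℓ ℓ) (≤-trans ℓ+ℓ≤n (n≤1+n n))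
    inner-length : 2 ≤ length (up zero 2 k ++ down (suc zero) 1 (suc k))
    inner-length = ≤-trans 2≤k (≤-trans (≤-reflexive (sym (length-up zero 2 k))) (length-++-≤ˡ (up zero 2 k)))
    outer-closing : Adj (place t (suc zero , blocks-end (ℓ + ℓ))) (place t (zero , ℓ))
    outer-closing = subst₂ (λ c w → Adj (place t (suc zero , c)) w) n≡ (place-+n t zero ℓ)
      (StripEdges.jump-edge (place-strip 2∣t) n 2∣n)

  Separated : Vertex 2 n → Vertex 2 n → Set
  Separated u v = ∃[ t ] 2 ∣ t × u ∈ map (place t) inner-cycle × v ∈ map (place t) outer-cycle

  separated⇒two-factor : ∀ {u v} → Separated u v →
    ∃[ C₁ ] ∃[ C₂ ] IsTwoCycleTwoFactor Adj C₁ C₂ × u ∈ C₁ × v ∈ C₂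
  separated⇒two-factor (t , 2∣t , u∈ , v∈) = _ , _ , layout-factor 2∣t , u∈ , v∈

  separate : ∀ {t d i j a c} → 2 ∣ t → 2 ∣ d → 1 ≤ a → d + a < ℓ → ℓ ≤ d + c → d + c ≤ n →
             Separated (place t (i , a)) (place t (j , c))
  separate {t} {d} {i} {j} {a} {c} 2∣t 2∣d 1≤a d+a<ℓ ℓ≤d+c d+c≤n =
    t + n ∸ d , ∣m∣n⇒∣m∸n (≤-trans d≤n (m≤n+m n t)) (∣m∣n⇒∣m+n 2∣t 2∣n) 2∣d ,
    subst (_∈ map (place (t + n ∸ d)) inner-cycle) (place-shift t i a d≤n)
      (∈-map⁺ (place (t + n ∸ d)) (complete inner-enumerates (box _ (≤-trans 1≤a (m≤n+m a d)) d+a<ℓ))) ,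
    subst (_∈ map (place (t + n ∸ d)) outer-cycle) (place-shift t j c d≤n)
      (∈-map⁺ (place (t + n ∸ d)) (complete outer-enumerates′ (box _ ℓ≤d+c (s≤s d+c≤n))))
    where
    d≤n : d ≤ n
    d≤n = ≤-trans (m≤m+n d c) d+c≤n

  separate-by-shift : ∀ {t d i j a c} → 2 ∣ t → 2 ∣ d → 1 ≤ a → d + a < ℓ → ℓ ≤ d + c → c ≤ n →
                      Separated (place t (i , a)) (place t (j , c))
  separate-by-shift {t} {d} {a = a} {c} 2∣t 2∣d 1≤a d+a<ℓ ℓ≤d+c c≤n with ℓ ≤? c
  ... | yes ℓ≤c = separate 2∣t (2 ∣0) 1≤a (≤-<-trans (m≤n+m a d) d+a<ℓ) ℓ≤c c≤n
  ... | no ℓ≰c = separate 2∣t 2∣d 1≤a d+a<ℓ ℓ≤d+c (≤-trans (<⇒≤ (+-mono-< d<ℓ (≰⇒> ℓ≰c))) ℓ+ℓ≤n)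
    where
    d<ℓ : d < ℓ
    d<ℓ = ≤-<-trans (m≤m+n d a) d+a<ℓ

  separate-from-1 : ∀ {t i j c} → 2 ∣ t → 1 ≤ c → c ≤ n → c ≢ 1 →
                    Separated (place t (i , 1)) (place t (j , c))
  separate-from-1 {c = c} 2∣t 1≤c c≤n c≢1 = separate-by-shift 2∣t 2∣k ≤-refl k+1<ℓ ℓ≤k+c c≤n
    where
    k+1<ℓ : k + 1 < ℓ
    k+1<ℓ = s≤s (≤-reflexive (+-comm k 1))
    ℓ≤k+c : ℓ ≤ k + c
    ℓ≤k+c = subst (_≤ k + c) (+-comm k 2) (+-monoʳ-≤ k (≤∧≢⇒< 1≤c (c≢1 ∘ sym)))

  even-4≤ : ∀ {c} → 2 ∣ c → 1 ≤ c → c ≢ 2 → 4 ≤ c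
  even-4≤ {1} 2∣c _ _ with n∣m⇒m%n≡0 1 2 2∣c
  ... | ()
  even-4≤ {2} _ _ c≢2 = ⊥-elim (c≢2 refl)
  even-4≤ {3} 2∣c _ _ with n∣m⇒m%n≡0 3 2 2∣c
  ... | ()
  even-4≤ {suc (suc (suc (suc c)))} _ _ _ = s≤s (s≤s (s≤s (s≤s z≤n)))

  separate-from-2 : ∀ {t i j c} → 2 ∣ t → 2 ∣ c → 1 ≤ c → c ≤ n → c ≢ 2 →
                    Separated (place t (i , 2)) (place t (j , c))
  separate-from-2 {c = c} 2∣t 2∣c 1≤c c≤n c≢2 =
    separate-by-shift 2∣t (∣m∣n⇒∣m∸n 2≤k 2∣k ∣-refl) (s≤s z≤n) d+2<ℓ ℓ≤d+c c≤n
    where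
    d+2≡k : k ∸ 2 + 2 ≡ k
    d+2≡k = m∸n+n≡m 2≤k
    d+2<ℓ : k ∸ 2 + 2 < ℓ
    d+2<ℓ = subst (_< ℓ) (sym d+2≡k) (n≤1+n (suc k))
    ℓ≤d+c : ℓ ≤ k ∸ 2 + c
    ℓ≤d+c = subst (_≤ k ∸ 2 + c) (trans (sym (+-assoc (k ∸ 2) 2 2)) (trans (cong (_+ 2) d+2≡k) (+-comm k 2)))
              (+-monoʳ-≤ (k ∸ 2) (even-4≤ 2∣c 1≤c c≢2))

  offsets-differ : ∀ {t j j′ a c} → j ≢ j′ → column (a + t) ≡ j → column (c + t) ≡ j′ → c ≢ a
  offsets-differ j≢j′ a↦j c↦j′ refl = j≢j′ (trans (sym a↦j) c↦j′)

  separate-from-odd : ∀ {i j i′ j′ a} → toℕ j ≡ suc a → 2 ∣ a → j ≢ j′ → Separated (i , j) (i′ , j′)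
  separate-from-odd {i} {j} {i′} {j′} {a} A≡ 2∣a j≢j′ with place-onto (a + n) (i′ , j′)
  ... | (_ , c) , box _ 1≤c c≤n , v≡ =
    subst₂ Separated u≡ v≡ (separate-from-1 (∣m∣n⇒∣m+n 2∣a 2∣n) 1≤c (s≤s⁻¹ c≤n)
                                           (offsets-differ j≢j′ (cong proj₂ u≡) (cong proj₂ v≡)))
    where
    u≡ : place (a + n) (i , 1) ≡ (i , j)
    u≡ = anchor {1} {a + n} i j (cong (_+ n) (sym A≡))

  separate-from-even : ∀ {i j i′ j′} → 2 ∣ toℕ j → 2 ∣ toℕ j′ → j ≢ j′ → Separated (i , j) (i′ , j′)
  separate-from-even {i} {j} {i′} {j′} 2∣A 2∣B j≢j′ with place-onto (toℕ j + n ∸ 2) (i′ , j′)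
  ... | (_ , c) , box _ 1≤c c≤n , v≡ =
    subst₂ Separated u≡ v≡
      (separate-from-2 2∣t (column-parity⇒even 2∣t (subst (λ w → 2 ∣ toℕ (proj₂ w)) (sym v≡) 2∣B))
                       1≤c (s≤s⁻¹ c≤n) (offsets-differ j≢j′ (cong proj₂ u≡) (cong proj₂ v≡)))
    where
    2≤A+n : 2 ≤ toℕ j + n
    2≤A+n = ≤-trans (≤-trans 2≤n-1 (n≤1+n n-1)) (m≤n+m n (toℕ j))
    2∣t : 2 ∣ toℕ j + n ∸ 2
    2∣t = ∣m∣n⇒∣m∸n 2≤A+n (∣m∣n⇒∣m+n 2∣A 2∣n) ∣-refl
    u≡ : place (toℕ j + n ∸ 2) (i , 2) ≡ (i , j)
    u≡ = anchor {2} {toℕ j + n ∸ 2} i j (m+[n∸m]≡n 2≤A+n)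

  separate-columns : ∀ {i j i′ j′} → j ≢ j′ → Separated (i , j) (i′ , j′) ⊎ Separated (i′ , j′) (i , j)
  separate-columns {j = j} {j′ = j′} j≢j′ with even⊎odd (toℕ j) | even⊎odd (toℕ j′)
  ... | inj₂ (a , A≡ , 2∣a) | _                    = inj₁ (separate-from-odd A≡ 2∣a j≢j′)
  ... | inj₁ _              | inj₂ (b , B≡ , 2∣b) = inj₂ (separate-from-odd B≡ 2∣b (j≢j′ ∘ sym))
  ... | inj₁ 2∣A            | inj₁ 2∣B            = inj₁ (separate-from-even 2∣A 2∣B j≢j′)

  two-spanning-cyclable : TwoSpanningCyclable Adj
  two-spanning-cyclable (i , j) (i′ , j′) u≢v with j Data.Fin.≟ j′
  ... | yes refl = _ , _ , row-factor (λ i≡i′ → u≢v (cong (_, j) i≡i′)) , ∈-row i j , ∈-row i′ j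
  ... | no j≢j′ with separate-columns j≢j′
  ...   | inj₁ sep = separated⇒two-factor sep
  ...   | inj₂ sep with separated⇒two-factor sep
  ...     | C₁ , C₂ , factor , v∈C₁ , u∈C₂ = C₂ , C₁ , two-factor-swap factor , u∈C₂ , v∈C₁

theorem3p3 : ∀ (ℓ n β γ : ℕ) → ℓ % 2 ≡ 0 → 2 < ℓ →
    n ≡ 2 * ℓ + (β * (ℓ + 2) + γ * ℓ) →
    TwoSpanningCyclable (HTGAdj 2 n ℓ)
theorem3p3 2 _ _ _ _ (s≤s (s≤s ())) _
theorem3p3 3 _ _ _ () _ _
theorem3p3 ℓ@(suc (suc k@(suc (suc _)))) _ β γ ℓ%2≡0 (s≤s (s≤s (s≤s _))) refl =
  Separation.two-spanning-cyclable k β γ _ 2∣k (s≤s (s≤s z≤n)) (width ℓ β γ)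
  where
  2∣k : 2 ∣ k
  2∣k = ∣m+n∣m⇒∣n (m%n≡0⇒n∣m ℓ 2 ℓ%2≡0) ∣-refl
  width : ∀ ℓ β γ → 2 * ℓ + (β * (ℓ + 2) + γ * ℓ) ≡ γ * ℓ + (β * (ℓ + 2) + (ℓ + ℓ))
  width = solve-∀
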